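{- Every satisfiable $\mathrm{GHyLTL}_{S+C}$ sentence $\varphi$ in prenex normal form (i.e., of the form $Q_1x_1.\cdots Q_kx_k.\,\psi$ with $Q_j\in\{\exists,\forall\}$ and $\psi$ quantifier-free) has a countable model, i.e., there is a countable set $\mathcal{L}$ of traces with $\mathcal{L}\models\varphi$.
   Context: A trace over a finite set $\mathrm{AP}$ of propositions is an infinite word $\sigma\in(2^{\mathrm{AP}})^\omega$; $\sigma(i)$ is its $i$-th letter ($i\ge 0$); a pointed trace is a pair $(\sigma,i)$ with $i\in\mathbb{N}$, initial if $i=0$. PLTL formulas: $\theta::=p\mid\neg\theta\mid\theta\vee\theta\mid\mathbf{X}\theta\mid\theta\,\mathbf{U}\,\theta\mid\mathbf{Y}\theta\mid\theta\,\mathbf{S}\,\theta$ with the standard semantics on pointed traces ($\mathbf{X}$ next, $\mathbf{U}$ until, $\mathbf{Y}\theta$ holds at $i$ iff $i>0$ and $\theta$ holds at $i-1$, $\theta_1\mathbf{S}\theta_2$ holds at $i$ iff some $i'\le i$ satisfies $\theta_2$ and all $j$ with $i'<j\le i$ satisfy $\theta_1$). Stuttering: for a finite set $\Gamma$ of PLTL formulas and a trace $\sigma$, $i$ is a proper $\Gamma$-changepoint of $\sigma$ if $i=0$, or $i>0$ and some $\theta\in\Gamma$ has different truth values at $(\sigma,i)$ and $(\sigma,i-1)$. If $\sigma$ has only finitely many proper $\Gamma$-changepoints, the largest being $i$, then $i+1,i+2,\dots$ are also declared $\Gamma$-changepoints. $\mathrm{succ}_\Gamma(\sigma,i)=(\sigma,i')$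 with $i'$ the least $\Gamma$-changepoint $>i$; for $i>0$, $\mathrm{pred}_\Gamma(\sigma,i)=(\sigma,i')$ with $i'$ the largest $\Gamma$-changepoint $<i$; $\mathrm{pred}_\Gamma(\sigma,0)$ is undefined. $\mathrm{GHyLTL}_{S+C}$: with trace variables $x\in\mathrm{VAR}$, formulas are $\varphi::=p_x\mid\neg\varphi\mid\varphi\vee\varphi\mid\langle C\rangle\varphi\mid\mathbf{X}_\Gamma\varphi\mid\varphi\,\mathbf{U}_\Gamma\,\varphi\mid\mathbf{Y}_\Gamma\varphi\mid\varphi\,\mathbf{S}_\Gamma\,\varphi\mid\exists x.\varphi\mid\forall x.\varphi$, with $C$ a nonempty subset of $\mathrm{VAR}$ (context) and $\Gamma$ a finite set of PLTL formulas; a sentence has no free variables. A trace assignment $\Pi$ maps some variables to pointed traces. $\mathrm{succ}_{(\Gamma,C)}(\Pi)$ applies $\mathrm{succ}_\Gamma$ to $\Pi(x)$ for $x\in C$ and leaves other variables unchanged; $\mathrm{pred}_{(\Gamma,C)}(\Pi)$ analogously, defined only if $\mathrm{pred}_\Gamma(\Pi(x))$ is defined for all $x\in C$. Semantics w.r.t. a set $\mathcal{L}$ of traces, $\Pi$ and a context $C$: $p_x$ holds iff $\Pi(x)=(\sigma,i)$ with $p\in\sigma(i)$; Booleans as usual; $\langle C'\rangle\varphi$ evaluates $\varphi$ with context $C'$; $\mathbf{X}_\Gamma\varphi$ evaluates $\varphi$ at $\mathrm{succ}_{(\Gamma,C)}(\Pi)$; $\varphi_1\mathbf{U}_\Gamma\varphi_2$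 holds iff some $i$ has $\varphi_2$ at $\mathrm{succ}^i_{(\Gamma,C)}(\Pi)$ and $\varphi_1$ at $\mathrm{succ}^j_{(\Gamma,C)}(\Pi)$ for all $j<i$; $\mathbf{Y}_\Gamma$ and $\mathbf{S}_\Gamma$ are the past duals using $\mathrm{pred}_{(\Gamma,C)}$ (requiring the predecessors used to be defined); $\exists x.\varphi$ ($\forall x.\varphi$) holds iff for some (all) $\sigma\in\mathcal{L}$, $\varphi$ holds under $\Pi[x\mapsto(\sigma,0)]$ with context $C$. For a sentence, $\mathcal{L}\models\varphi$ iff $(\mathcal{L},\emptyset,\mathrm{VAR})\models\varphi$; $\varphi$ is satisfiable if some set of traces satisfies it. -}

module Defs where

open import Data.Nat using (ℕ; zero; suc; _<_; _≤_; _≡ᵇ_)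
open import Data.Fin using (Fin)
open import Data.Bool using (Bool; true; false; if_then_else_)
open import Data.Maybe using (Maybe; just; nothing)
open import Data.List using (List; []; _∷_)
open import Data.List.NonEmpty using (List⁺; toList)
open import Data.List.Membership.Propositional using (_∈_)
open import Data.Product using (Σ; _×_; _,_)
open import Data.Sum using (_⊎_)
open import Data.Empty using (⊥)
open import Relation.Nullary using (¬_)
open import Relation.Binary.PropositionalEquality using (_≡_)
open import Function.Bundles using (_⇔_)

Letter : ℕ → Set
Letter n = Fin n → Bool

Trace : ℕ → Set
Trace n = ℕ → Letter n

_≈ᵗ_ : ∀ {n} → Trace n → Trace n → Set
σ ≈ᵗ σ' = ∀ i p → σ i p ≡ σ' i p

data PLTL (n : ℕ) : Set where
  atom  : Fin n → PLTL n
  neg   : PLTL n → PLTL n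
  or    : PLTL n → PLTL n → PLTL n
  next  : PLTL n → PLTL n
  until : PLTL n → PLTL n → PLTL n
  yest  : PLTL n → PLTL n
  since : PLTL n → PLTL n → PLTL n

holds : ∀ {n} → Trace n → PLTL n → ℕ → Set
holds σ (atom p) i = σ i p ≡ true
holds σ (neg θ) i = ¬ holds σ θ i
holds σ (or θ₁ θ₂) i = holds σ θ₁ i ⊎ holds σ θ₂ i
holds σ (next θ) i = holds σ θ (suc i)
holds σ (until θ₁ θ₂) i =
  Σ ℕ λ k → i ≤ k × holds σ θ₂ k × (∀ j → i ≤ j → j < k → holds σ θ₁ j)
holds σ (yest θ) zero = ⊥
holds σ (yest θ) (suc i) = holds σ θ i
holds σ (since θ₁ θ₂) i =
  Σ ℕ λ k → k ≤ i × holds σ θ₂ k × (∀ j → k < j → j ≤ i → holds σ θ₁ j)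

differ : ∀ {n} → Trace n → PLTL n → ℕ → ℕ → Set
differ σ θ i i' = (holds σ θ i × ¬ holds σ θ i') ⊎ (¬ holds σ θ i × holds σ θ i')

ProperCP : ∀ {n} → List (PLTL n) → Trace n → ℕ → Set
ProperCP Γ σ zero = Data.Unit.⊤ where import Data.Unit
ProperCP Γ σ (suc i) = Σ _ λ θ → θ ∈ Γ × differ σ θ (suc i) i

-- i is a Γ-changepoint: proper, or it lies after the largest proper
-- changepoint (when there are only finitely many)
ChangePoint : ∀ {n} → List (PLTL n) → Trace n → ℕ → Set
ChangePoint Γ σ i =
  ProperCP Γ σ i ⊎
  (Σ ℕ λ i₀ → i₀ < i × ProperCP Γ σ i₀ × (∀ j → i₀ < j → ¬ ProperCP Γ σ j))

SuccΓ : ∀ {n} → List (PLTL n) → Trace n → ℕ → ℕ → Set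
SuccΓ Γ σ i i' =
  i < i' × ChangePoint Γ σ i' × (∀ j → i < j → j < i' → ¬ ChangePoint Γ σ j)

PredΓ : ∀ {n} → List (PLTL n) → Trace n → ℕ → ℕ → Set
PredΓ Γ σ i i' =
  i' < i × ChangePoint Γ σ i' × (∀ j → i' < j → j < i → ¬ ChangePoint Γ σ j)

VAR : Set
VAR = ℕ

data Form (n : ℕ) : Set where
  prop  : Fin n → VAR → Form n
  neg   : Form n → Form n
  or    : Form n → Form n → Form n
  ctx   : List⁺ VAR → Form n → Form n
  next  : List (PLTL n) → Form n → Form n
  until : List (PLTL n) → Form n → Form n → Form n
  yest  : List (PLTL n) → Form n → Form n
  since : List (PLTL n) → Form n → Form n → Form n
  ex    : VAR → Form n → Form n
  all   : VAR → Form n → Form n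

Ctx : Set
Ctx = VAR → Bool

memb : List VAR → VAR → Bool
memb [] x = false
memb (y ∷ ys) x = if x ≡ᵇ y then true else memb ys x

-- A trace assignment Π is represented by its trace part τ (partial)
-- and its position part pos: Π(x) = (σ , pos x) when τ x = just σ,
-- undefined when τ x = nothing.
TAsgTr : ℕ → Set
TAsgTr n = VAR → Maybe (Trace n)

TAsgPos : Set
TAsgPos = VAR → ℕ

stepVar : ∀ {n} → (Trace n → ℕ → ℕ → Set) → Bool → Maybe (Trace n) → ℕ → ℕ → Set
stepVar R true (just σ) i i' = R σ i i'
stepVar R true nothing i i' = i' ≡ i
stepVar R false _ i i' = i' ≡ i

SuccA : ∀ {n} → List (PLTL n) → Ctx → TAsgTr n → TAsgPos → TAsgPos → Set
SuccA Γ C τ pos pos' = ∀ x → stepVar (SuccΓ Γ) (C x) (τ x) (pos x) (pos' x)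

PredA : ∀ {n} → List (PLTL n) → Ctx → TAsgTr n → TAsgPos → TAsgPos → Set
PredA Γ C τ pos pos' = ∀ x → stepVar (PredΓ Γ) (C x) (τ x) (pos x) (pos' x)

propAt : ∀ {n} → Fin n → Maybe (Trace n) → ℕ → Set
propAt p nothing i = ⊥
propAt p (just σ) i = σ i p ≡ true

updTr : ∀ {n} → TAsgTr n → VAR → Trace n → TAsgTr n
updTr τ x σ y = if y ≡ᵇ x then just σ else τ y

updPos : TAsgPos → VAR → TAsgPos
updPos pos x y = if y ≡ᵇ x then 0 else pos y

sat : ∀ {n} → (Trace n → Set) → Form n → TAsgTr n → TAsgPos → Ctx → Set
sat L (prop p x) τ pos C = propAt p (τ x) (pos x)
sat L (neg φ) τ pos C = ¬ sat L φ τ pos C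
sat L (or φ ψ) τ pos C = sat L φ τ pos C ⊎ sat L ψ τ pos C
sat L (ctx C' φ) τ pos C = sat L φ τ pos (memb (toList C'))
sat L (next Γ φ) τ pos C =
  Σ TAsgPos λ pos' → SuccA Γ C τ pos pos' × sat L φ τ pos' C
sat L (until Γ φ ψ) τ pos C =
  Σ ℕ λ k → Σ (ℕ → TAsgPos) λ ps →
    (∀ x → ps 0 x ≡ pos x) ×
    (∀ j → j < k → SuccA Γ C τ (ps j) (ps (suc j))) ×
    sat L ψ τ (ps k) C ×
    (∀ j → j < k → sat L φ τ (ps j) C)
sat L (yest Γ φ) τ pos C =
  Σ TAsgPos λ pos' → PredA Γ C τ pos pos' × sat L φ τ pos' C
sat L (since Γ φ ψ) τ pos C =
  Σ ℕ λ k → Σ (ℕ → TAsgPos) λ ps →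
    (∀ x → ps 0 x ≡ pos x) ×
    (∀ j → j < k → PredA Γ C τ (ps j) (ps (suc j))) ×
    sat L ψ τ (ps k) C ×
    (∀ j → j < k → sat L φ τ (ps j) C)
sat L (ex x φ) τ pos C =
  Σ (Trace _) λ σ → L σ × sat L φ (updTr τ x σ) (updPos pos x) C
sat L (all x φ) τ pos C =
  (σ : Trace _) → L σ → sat L φ (updTr τ x σ) (updPos pos x) C

_⊨_ : ∀ {n} → (Trace n → Set) → Form n → Set
L ⊨ φ = sat L φ (λ _ → nothing) (λ _ → 0) (λ _ → true)

Scoped : ∀ {n} → List VAR → Form n → Set
Scoped b (prop p x) = x ∈ b
Scoped b (neg φ) = Scoped b φ
Scoped b (or φ ψ) = Scoped b φ × Scoped b ψ
Scoped b (ctx C φ) = Scoped b φ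
Scoped b (next Γ φ) = Scoped b φ
Scoped b (until Γ φ ψ) = Scoped b φ × Scoped b ψ
Scoped b (yest Γ φ) = Scoped b φ
Scoped b (since Γ φ ψ) = Scoped b φ × Scoped b ψ
Scoped b (ex x φ) = Scoped (x ∷ b) φ
Scoped b (all x φ) = Scoped (x ∷ b) φ

Sentence : ∀ {n} → Form n → Set
Sentence φ = Scoped [] φ

data QuantFree {n : ℕ} : Form n → Set where
  qf-prop  : ∀ {p x} → QuantFree (prop p x)
  qf-neg   : ∀ {φ} → QuantFree φ → QuantFree (neg φ)
  qf-or    : ∀ {φ ψ} → QuantFree φ → QuantFree ψ → QuantFree (or φ ψ)
  qf-ctx   : ∀ {C φ} → QuantFree φ → QuantFree (ctx C φ)
  qf-next  : ∀ {Γ φ} → QuantFree φ → QuantFree (next Γ φ)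
  qf-until : ∀ {Γ φ ψ} → QuantFree φ → QuantFree ψ → QuantFree (until Γ φ ψ)
  qf-yest  : ∀ {Γ φ} → QuantFree φ → QuantFree (yest Γ φ)
  qf-since : ∀ {Γ φ ψ} → QuantFree φ → QuantFree ψ → QuantFree (since Γ φ ψ)

data Prenex {n : ℕ} : Form n → Set where
  pn-qf  : ∀ {φ} → QuantFree φ → Prenex φ
  pn-ex  : ∀ {x φ} → Prenex φ → Prenex (ex x φ)
  pn-all : ∀ {x φ} → Prenex φ → Prenex (all x φ)

Satisfiable : ∀ {n} → Form n → Set₁
Satisfiable {n} φ = Σ (Trace n → Set) λ L → L ⊨ φ

-- L is countable: it is (up to pointwise equality of traces) the set of
-- traces listed by some enumeration e : ℕ → Maybe Trace (nothing = no
-- entry, so finite and empty sets are included).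
Countable : ∀ {n} → (Trace n → Set) → Set
Countable {n} L = Σ (ℕ → Maybe (Trace n)) λ e →
  ∀ σ → L σ ⇔ (Σ ℕ λ k → Σ (Trace n) λ σ' → e k ≡ just σ' × σ' ≈ᵗ σ)

{-# OPTIONS --safe #-}
-- A proof of L ⊨ φ for prenex φ is a system of Skolem functions: it picks a
-- witness in L for each existential quantifier from the traces chosen for the
-- universal quantifiers before it.  Closing ∅ ω times under these functions
-- yields a countable subset of L, and the same proof, with its universal
-- quantifiers restricted to that subset, shows that it satisfies φ: the
-- quantifier-free matrix is evaluated on the same traces, and its truth does
-- not depend on the model and respects pointwise equality of traces.
module Submission where

open import Defs
open import Data.Nat using (ℕ; zero; suc; _+_; _≤_; _≤′_; ≤′-reflexive; ≤′-step; _≡ᵇ_; _⊔_)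
open import Data.Nat.Properties using (+-suc; +-identityʳ; suc-injective; ≤⇒≤′; m≤m⊔n; m≤n⊔m)
open import Data.Product using (Σ; ∃; _×_; _,_; proj₁; proj₂; uncurry)
open import Data.Sum using (inj₁; inj₂)
open import Data.Maybe using (Maybe; just; nothing; maybe′)
import Data.Maybe as Maybe
open import Data.Maybe.Properties using (map-just)
open import Data.Maybe.Relation.Binary.Pointwise using (Pointwise; just; nothing)
import Data.Maybe.Relation.Binary.Pointwise as Pointwise
open import Data.Bool using (true; false)
open import Relation.Binary.PropositionalEquality using (_≡_; refl; sym; trans; cong; subst)
open import Function using (id; _∘′_)
open import Function.Bundles using (mk⇔)

unpair-next : ℕ × ℕ → ℕ × ℕ
unpair-next (zero  , b) = suc b , zero
unpair-next (suc a , b) = a , suc b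

-- Cantor's enumeration of ℕ × ℕ along the diagonals a + b = s.
unpair : ℕ → ℕ × ℕ
unpair zero    = zero , zero
unpair (suc k) = unpair-next (unpair k)

unpair-surjective : ∀ a b → ∃ λ k → unpair k ≡ (a , b)
unpair-surjective a b = onDiagonal (a + b) a b refl
  where
  onDiagonal : ∀ s a b → a + b ≡ s → ∃ λ k → unpair k ≡ (a , b)
  onDiagonal s a (suc b) eq
    with k , eq′ ← onDiagonal s (suc a) b (trans (sym (+-suc a b)) eq)
    = suc k , cong unpair-next eq′
  onDiagonal (suc s) (suc a) zero eq
    with k , eq′ ← onDiagonal s zero a (trans (sym (+-identityʳ a)) (suc-injective eq))
    = suc k , cong unpair-next eq′
  onDiagonal zero    zero    zero refl = zero , refl
  onDiagonal zero    (suc a) zero ()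
  onDiagonal (suc s) zero    zero ()

module Enumeration where

  Enum : Set → Set
  Enum A = ℕ → Maybe A

  module _ {A : Set} where

    infix 4 _∈_ _⊆_
    record _∈_ (x : A) (c : Enum A) : Set where
      constructor listed
      field
        index    : ℕ
        at-index : c index ≡ just x

    _⊆_ : Enum A → Enum A → Set
    c ⊆ d = ∀ {x} → x ∈ c → x ∈ d

    ∅ : Enum A
    ∅ _ = nothing

    ｛_｝ : A → Enum A
    ｛ x ｝ _ = just x

    -- Opaque, so that f can be inferred from x ∈ ⋃ f.
    opaque
      ⋃ : (ℕ → Enum A) → Enum A
      ⋃ f k = uncurry f (unpair k)

      ∈-⋃⁺ : ∀ {f x} a → x ∈ f a → x ∈ ⋃ f
      ∈-⋃⁺ {f} {x} a (listed b eq) with k , eq′ ← unpair-surjective a b =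
        listed k (subst (λ ab → uncurry f ab ≡ just x) (sym eq′) eq)

      ∈-⋃⁻ : ∀ {f x} → x ∈ ⋃ f → ∃ λ a → x ∈ f a
      ∈-⋃⁻ (listed k eq) = proj₁ (unpair k) , listed (proj₂ (unpair k)) eq

    infixr 6 _∪_
    _∪_ : Enum A → Enum A → Enum A
    c ∪ d = ⋃ λ { zero → c ; (suc _) → d }

    ∅-⊆ : ∀ {c} → ∅ ⊆ c
    ∅-⊆ (listed _ ())

    ∈-｛｝ : ∀ {x} → x ∈ ｛ x ｝
    ∈-｛｝ = listed 0 refl

    ∈-∪ˡ : ∀ {c d x} → x ∈ c → x ∈ c ∪ d
    ∈-∪ˡ = ∈-⋃⁺ 0

    ∈-∪ʳ : ∀ {c d x} → x ∈ d → x ∈ c ∪ d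
    ∈-∪ʳ = ∈-⋃⁺ 1

    ∪-monoʳ : ∀ {c d d′} → d ⊆ d′ → c ∪ d ⊆ c ∪ d′
    ∪-monoʳ d⊆d′ x∈ with ∈-⋃⁻ x∈
    ... | zero  , x∈c = ∈-∪ˡ x∈c
    ... | suc _ , x∈d = ∈-∪ʳ (d⊆d′ x∈d)

  module _ {A B : Set} where

    infixl 1 _>>=_
    _>>=_ : Enum A → (A → Enum B) → Enum B
    c >>= F = ⋃ λ a → maybe′ F ∅ (c a)

    ∈->>=⁺ : ∀ {c F x y} → x ∈ c → y ∈ F x → y ∈ (c >>= F)
    ∈->>=⁺ {c} {F} {y = y} (listed a eq) (listed b eq′) =
      ∈-⋃⁺ a (listed b (subst (λ m → maybe′ F ∅ m b ≡ just y) (sym eq) eq′))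

    ∈->>=⁻ : ∀ {c F y} → y ∈ (c >>= F) → ∃ λ x → x ∈ c × y ∈ F x
    ∈->>=⁻ {c} {F} y∈ with ∈-⋃⁻ {f = λ a → maybe′ F ∅ (c a)} y∈
    ... | a , listed b eq′ with c a in eq
    ...   | just x = x , listed a eq , listed b eq′

    >>=-mono : ∀ {c c′ F F′} → c ⊆ c′ → (∀ x → F x ⊆ F′ x) → (c >>= F) ⊆ (c′ >>= F′)
    >>=-mono c⊆c′ F⊆F′ y∈ with x , x∈c , y∈Fx ← ∈->>=⁻ y∈ =
      ∈->>=⁺ (c⊆c′ x∈c) (F⊆F′ x y∈Fx)

open Enumeration

module _ {n : ℕ} where

  ≈ᵗ-refl : {σ : Trace n} → σ ≈ᵗ σ
  ≈ᵗ-refl _ _ = refl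

  ≈ᵗ-sym : {σ σ′ : Trace n} → σ ≈ᵗ σ′ → σ′ ≈ᵗ σ
  ≈ᵗ-sym e i p = sym (e i p)

  holds-resp : {σ σ′ : Trace n} → σ ≈ᵗ σ′ → ∀ θ {i} → holds σ θ i → holds σ′ θ i
  holds-resp e (atom p) {i} h = trans (sym (e i p)) h
  holds-resp e (neg θ) h h′ = h (holds-resp (≈ᵗ-sym e) θ h′)
  holds-resp e (or θ₁ θ₂) (inj₁ h) = inj₁ (holds-resp e θ₁ h)
  holds-resp e (or θ₁ θ₂) (inj₂ h) = inj₂ (holds-resp e θ₂ h)
  holds-resp e (next θ) h = holds-resp e θ h
  holds-resp e (until θ₁ θ₂) (k , i≤k , h₂ , h₁) =
    k , i≤k , holds-resp e θ₂ h₂ , λ j i≤j j<k → holds-resp e θ₁ (h₁ j i≤j j<k)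
  holds-resp e (yest θ) {suc i} h = holds-resp e θ h
  holds-resp e (since θ₁ θ₂) (k , k≤i , h₂ , h₁) =
    k , k≤i , holds-resp e θ₂ h₂ , λ j k<j j≤i → holds-resp e θ₁ (h₁ j k<j j≤i)

  differ-resp : {σ σ′ : Trace n} → σ ≈ᵗ σ′ → ∀ θ {i i′} → differ σ θ i i′ → differ σ′ θ i i′
  differ-resp e θ (inj₁ (h , ¬h′)) =
    inj₁ (holds-resp e θ h , λ h′ → ¬h′ (holds-resp (≈ᵗ-sym e) θ h′))
  differ-resp e θ (inj₂ (¬h , h′)) =
    inj₂ ((λ h → ¬h (holds-resp (≈ᵗ-sym e) θ h)) , holds-resp e θ h′)

  properCP-resp : {σ σ′ : Trace n} → σ ≈ᵗ σ′ → ∀ {Γ} i → ProperCP Γ σ i → ProperCP Γ σ′ i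
  properCP-resp e zero    cp = cp
  properCP-resp e (suc i) (θ , θ∈Γ , d) = θ , θ∈Γ , differ-resp e θ d

  changePoint-resp : {σ σ′ : Trace n} → σ ≈ᵗ σ′ → ∀ {Γ i} → ChangePoint Γ σ i → ChangePoint Γ σ′ i
  changePoint-resp e {i = i} (inj₁ cp) = inj₁ (properCP-resp e i cp)
  changePoint-resp e (inj₂ (i₀ , i₀<i , cp₀ , last)) =
    inj₂ (i₀ , i₀<i , properCP-resp e i₀ cp₀ ,
          λ j i₀<j cp → last j i₀<j (properCP-resp (≈ᵗ-sym e) j cp))

  succΓ-resp : ∀ {Γ} {σ σ′ : Trace n} {i i′} → σ ≈ᵗ σ′ → SuccΓ Γ σ i i′ → SuccΓ Γ σ′ i i′
  succΓ-resp e (i<i′ , cp , between) =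
    i<i′ , changePoint-resp e cp ,
    λ j i<j j<i′ cp′ → between j i<j j<i′ (changePoint-resp (≈ᵗ-sym e) cp′)

  predΓ-resp : ∀ {Γ} {σ σ′ : Trace n} {i i′} → σ ≈ᵗ σ′ → PredΓ Γ σ i i′ → PredΓ Γ σ′ i i′
  predΓ-resp e (i′<i , cp , between) =
    i′<i , changePoint-resp e cp ,
    λ j i′<j j<i cp′ → between j i′<j j<i (changePoint-resp (≈ᵗ-sym e) cp′)

  infix 4 _≈ᵃ_
  _≈ᵃ_ : TAsgTr n → TAsgTr n → Set
  τ ≈ᵃ τ′ = ∀ x → Pointwise _≈ᵗ_ (τ x) (τ′ x)

  ≈ᵃ-refl : ∀ {τ} → τ ≈ᵃ τ
  ≈ᵃ-refl x = Pointwise.refl ≈ᵗ-refl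

  ≈ᵃ-sym : ∀ {τ τ′} → τ ≈ᵃ τ′ → τ′ ≈ᵃ τ
  ≈ᵃ-sym r x = Pointwise.sym ≈ᵗ-sym (r x)

  updTr-resp : ∀ {τ τ′} → τ ≈ᵃ τ′ → ∀ x {σ σ′} → σ ≈ᵗ σ′ → updTr τ x σ ≈ᵃ updTr τ′ x σ′
  updTr-resp r x e y with y ≡ᵇ x
  ... | true  = just e
  ... | false = r y

  stepVar-resp : {R : Trace n → ℕ → ℕ → Set} →
                 (∀ {σ σ′ i i′} → σ ≈ᵗ σ′ → R σ i i′ → R σ′ i i′) →
                 ∀ b {a a′ i i′} → Pointwise _≈ᵗ_ a a′ → stepVar R b a i i′ → stepVar R b a′ i i′
  stepVar-resp R-resp true  (just e) s = R-resp e s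
  stepVar-resp R-resp true  nothing  s = s
  stepVar-resp R-resp false _        s = s

  succA-resp : ∀ {Γ C τ τ′ pos pos′} → τ ≈ᵃ τ′ → SuccA Γ C τ pos pos′ → SuccA Γ C τ′ pos pos′
  succA-resp {Γ} {C} r s x = stepVar-resp {R = SuccΓ Γ} succΓ-resp (C x) (r x) (s x)

  predA-resp : ∀ {Γ C τ τ′ pos pos′} → τ ≈ᵃ τ′ → PredA Γ C τ pos pos′ → PredA Γ C τ′ pos pos′
  predA-resp {Γ} {C} r s x = stepVar-resp {R = PredΓ Γ} predΓ-resp (C x) (r x) (s x)

  propAt-resp : ∀ {p} {a a′ : Maybe (Trace n)} {i} →
                Pointwise _≈ᵗ_ a a′ → propAt p a i → propAt p a′ i
  propAt-resp {p} {i = i} (just e) h = trans (sym (e i p)) h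

  quantFree-sat-transfer : ∀ {L L′ : Trace n → Set} {φ} → QuantFree φ →
                           ∀ {τ τ′ pos C} → τ ≈ᵃ τ′ → sat L φ τ pos C → sat L′ φ τ′ pos C
  quantFree-sat-transfer (qf-prop {x = x}) r h = propAt-resp (r x) h
  quantFree-sat-transfer {L} {L′} (qf-neg q) r h h′ =
    h (quantFree-sat-transfer {L′} {L} q (≈ᵃ-sym r) h′)
  quantFree-sat-transfer (qf-or q₁ q₂) r (inj₁ h) = inj₁ (quantFree-sat-transfer q₁ r h)
  quantFree-sat-transfer (qf-or q₁ q₂) r (inj₂ h) = inj₂ (quantFree-sat-transfer q₂ r h)
  quantFree-sat-transfer (qf-ctx q) r h = quantFree-sat-transfer q r h
  quantFree-sat-transfer (qf-next q) {C = C} r (pos′ , s , h) =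
    pos′ , succA-resp {C = C} r s , quantFree-sat-transfer q r h
  quantFree-sat-transfer (qf-until q₁ q₂) {C = C} r (k , ps , ps₀ , steps , h₂ , h₁) =
    k , ps , ps₀ , (λ j j<k → succA-resp {C = C} r (steps j j<k)) ,
    quantFree-sat-transfer q₂ r h₂ , λ j j<k → quantFree-sat-transfer q₁ r (h₁ j j<k)
  quantFree-sat-transfer (qf-yest q) {C = C} r (pos′ , s , h) =
    pos′ , predA-resp {C = C} r s , quantFree-sat-transfer q r h
  quantFree-sat-transfer (qf-since q₁ q₂) {C = C} r (k , ps , ps₀ , steps , h₂ , h₁) =
    k , ps , ps₀ , (λ j j<k → predA-resp {C = C} r (steps j j<k)) ,
    quantFree-sat-transfer q₂ r h₂ , λ j j<k → quantFree-sat-transfer q₁ r (h₁ j j<k)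

  Enumerated : (ℕ → Maybe (Trace n)) → Trace n → Set
  Enumerated e σ = Σ ℕ λ k → Σ (Trace n) λ σ′ → e k ≡ just σ′ × σ′ ≈ᵗ σ

  enumerated-countable : ∀ e → Countable (Enumerated e)
  enumerated-countable e = e , λ _ → mk⇔ id id

module SkolemHull {n : ℕ} (L : Trace n → Set) where

  -- The proof of L σ is kept so that a universal hypothesis can be applied to σ.
  Witness : Set
  Witness = Σ (Trace n) L

  skolem : ∀ {φ} → Prenex φ → ∀ {τ pos C} → sat L φ τ pos C → Enum Witness → Enum Witness
  skolem (pn-qf _)  _           c = ∅
  skolem (pn-ex P)  (σ , l , π) c = ｛ σ , l ｝ ∪ skolem P π c
  skolem (pn-all P) π           c = c >>= λ w → skolem P (π (proj₁ w) (proj₂ w)) c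

  skolem-mono : ∀ {φ} (P : Prenex φ) {τ pos C} (π : sat L φ τ pos C) {c c′} →
                c ⊆ c′ → skolem P π c ⊆ skolem P π c′
  skolem-mono (pn-qf _)  _           c⊆c′ = ∅-⊆
  skolem-mono (pn-ex P)  (σ , l , π) c⊆c′ = ∪-monoʳ (skolem-mono P π c⊆c′)
  skolem-mono (pn-all P) π           c⊆c′ =
    >>=-mono c⊆c′ λ w → skolem-mono P (π (proj₁ w) (proj₂ w)) c⊆c′

  traces : Enum Witness → ℕ → Maybe (Trace n)
  traces c k = Maybe.map proj₁ (c k)

  traces-inv : ∀ c {k σ} → traces c k ≡ just σ → ∃ λ l → (σ , l) ∈ c
  traces-inv c {k} eq with c k in eq′
  traces-inv c {k} refl | just (σ , l) = l , listed k eq′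

  module _ (stage : ℕ → Enum Witness) (stage-mono : ∀ {m m′} → m ≤ m′ → stage m ⊆ stage m′) where

    Hull : Trace n → Set
    Hull = Enumerated (traces (⋃ stage))

    -- Closure is assumed stagewise, not for ⋃ stage: this is the form the universal
    -- case passes on, as a trace of the hull lies in some stage and monotonicity moves
    -- it and any stage m′ to the common later stage m ⊔ m′.
    hull-sat : ∀ {φ} (P : Prenex φ) {τ τ′ pos C} (π : sat L φ τ pos C) → τ ≈ᵃ τ′ →
               (∀ m → skolem P π (stage m) ⊆ ⋃ stage) → sat Hull φ τ′ pos C
    hull-sat (pn-qf q) π r _ = quantFree-sat-transfer q r π
    hull-sat (pn-ex {x} P) (σ , l , π) r closed
      with listed k eq ← closed 0 (∈-∪ˡ ∈-｛｝) =
      σ , (k , σ , map-just eq , ≈ᵗ-refl) ,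
      hull-sat P π (updTr-resp r x ≈ᵗ-refl) (λ m w∈ → closed m (∈-∪ʳ w∈))
    hull-sat (pn-all {x} P) π r closed σ (k , σ′ , eq , σ′≈σ)
      with l , σ′∈ ← traces-inv (⋃ stage) eq
      with m , σ′∈stage ← ∈-⋃⁻ σ′∈ =
      hull-sat P (π σ′ l) (updTr-resp r x σ′≈σ) closed′
      where
      closed′ : ∀ m′ → skolem P (π σ′ l) (stage m′) ⊆ ⋃ stage
      closed′ m′ w∈ =
        closed (m ⊔ m′) (∈->>=⁺ (stage-mono (m≤m⊔n m m′) σ′∈stage)
                                (skolem-mono P (π σ′ l) (stage-mono (m≤n⊔m m m′)) w∈))

  module _ {φ} (P : Prenex φ) {τ pos C} (π : sat L φ τ pos C) where

    stage : ℕ → Enum Witness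
    stage zero    = ∅
    stage (suc m) = stage m ∪ skolem P π (stage m)

    stage-mono : ∀ {m m′} → m ≤ m′ → stage m ⊆ stage m′
    stage-mono m≤m′ = go (≤⇒≤′ m≤m′)
      where
      go : ∀ {m m′} → m ≤′ m′ → stage m ⊆ stage m′
      go (≤′-reflexive refl) = id
      go (≤′-step h)         = ∈-∪ˡ ∘′ go h

    skolem-stage-⊆ : ∀ m → skolem P π (stage m) ⊆ ⋃ stage
    skolem-stage-⊆ m w∈ = ∈-⋃⁺ (suc m) (∈-∪ʳ w∈)

    countable-submodel : Σ (Trace n → Set) λ L′ → Countable L′ × sat L′ φ τ pos C
    countable-submodel =
      Hull stage stage-mono , enumerated-countable _ ,
      hull-sat stage stage-mono P π ≈ᵃ-refl skolem-stage-⊆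

mainTheorem2 : (n : ℕ) (φ : Form n) → Sentence φ → Prenex φ → Satisfiable φ →
    Σ (Trace n → Set) λ L → Countable L × L ⊨ φ
mainTheorem2 _ _ _ P (L , L⊨φ) = SkolemHull.countable-submodel L P L⊨φ
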